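{- Let $k \geq 2$ and let $G$ be a graph on $n \geq 4k$ vertices with $\sigma_2(G) \geq 6k-2$ such that $G$ does not contain $k$ vertex-disjoint chorded cycles, but $G + e$ does for every $e \in E(\overline{G})$. Let $\mathcal C$ be a collection of $k-1$ vertex-disjoint chorded cycles of $G$ chosen so that (O1) the total number of vertices in the cycles of $\mathcal C$ is minimum; (O2) subject to (O1), the total number of chords is maximum; (O3) subject to (O1) and (O2), the number of vertices of a longest path in $R := G - \bigcup_{C \in \mathcal C} V(C)$ is maximum. Let $P$ be a longest path in $R$, let $p$ be an endpoint of $P$, and suppose $V(R) \neq V(P)$. Then for every $v \in V(R)\setminus V(P)$, $\|\{v,p\}, R\| \geq 4$, and hence $\|v,R\| \geq 2$. Moreover, $|P| \geq 3$.
   Context: All graphs are finite and simple. $\sigma_2(G) := \min\{d_G(x)+d_G(y) : x \neq y,\ xy \notin E(G)\}$. A chorded cycle is a cycle together with at least one chord (an edge of $G$ joining two non-consecutive vertices of the cycle). $|P|$ is the number of vertices of $P$. For $A \subseteq V(G)$ and a subgraph $R$, $\|A,R\| := \sum_{a\in A}|N_G(a)\cap V(R)|$. -}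

module Defs where

open import Data.Nat using (ℕ; zero; suc; _+_; _∸_; _≤_; _<_)
open import Data.Nat.Properties using ()
open import Data.Bool using (Bool; true; false; if_then_else_; _∧_; _∨_; not)
open import Data.Fin using (Fin; toℕ; _≟_)
open import Data.Fin.Properties using (all?; any?)
open import Data.List using (List; map; allFin)
open import Data.Nat.ListAction using (sum)
open import Data.Product using (Σ; ∃; _×_; _,_)
open import Data.Sum using (_⊎_)
open import Relation.Nullary using (¬_; Dec; does; ¬?)
open import Relation.Nullary.Decidable using (_×-dec_)
open import Relation.Binary.PropositionalEquality using (_≡_; _≢_)

Graph : ℕ → Set
Graph n = Fin n → Fin n → Bool

IsSimple : ∀ {n} → Graph n → Set
IsSimple {n} G = (∀ (x y : Fin n) → G x y ≡ G y x) × (∀ (x : Fin n) → G x x ≡ false)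

Edge : ∀ {n} → Graph n → Fin n → Fin n → Set
Edge G x y = G x y ≡ true

∑ : (m : ℕ) → (Fin m → ℕ) → ℕ
∑ m f = sum (map f (allFin m))

ind : Bool → ℕ
ind true = 1
ind false = 0

deg : ∀ {n} → Graph n → Fin n → ℕ
deg {n} G x = ∑ n (λ y → ind (G x y))

-- σ₂(G) ≥ s : every pair of distinct non-adjacent vertices has degree sum ≥ s
-- (vacuous when G is complete, i.e. σ₂ = min ∅ = ∞).
σ₂≥ : ∀ {n} → Graph n → ℕ → Set
σ₂≥ {n} G s = ∀ (x y : Fin n) → x ≢ y → G x y ≡ false → s ≤ deg G x + deg G y

addEdge : ∀ {n} → Graph n → Fin n → Fin n → Graph n
addEdge G x y u v =
  G u v ∨ ((does (u ≟ x) ∧ does (v ≟ y)) ∨ (does (u ≟ y) ∧ does (v ≟ x)))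

CycNext : (m : ℕ) → Fin m → Fin m → Set
CycNext m i j = (suc (toℕ i) ≡ toℕ j) ⊎ ((suc (toℕ i) ≡ m) × (toℕ j ≡ 0))

cycNextᵇ : (m : ℕ) → Fin m → Fin m → Bool
cycNextᵇ m i j = (suc (toℕ i) Data.Nat.≡ᵇ toℕ j) ∨ ((suc (toℕ i) Data.Nat.≡ᵇ m) ∧ (toℕ j Data.Nat.≡ᵇ 0))

record Cycle {n : ℕ} (G : Graph n) : Set where
  field
    len  : ℕ
    len≥3 : 3 ≤ len
    vert : Fin len → Fin n
    inj  : ∀ (i j : Fin len) → vert i ≡ vert j → i ≡ j
    adj  : ∀ (i j : Fin len) → CycNext len i j → Edge G (vert i) (vert j)
open Cycle public

IsChord : ∀ {n} {G : Graph n} (C : Cycle G) → Fin (len C) → Fin (len C) → Set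
IsChord {G = G} C i j =
  (i ≢ j) × (¬ CycNext (len C) i j) × (¬ CycNext (len C) j i) × Edge G (vert C i) (vert C j)

Chorded : ∀ {n} {G : Graph n} → Cycle G → Set
Chorded C = ∃ λ i → ∃ λ j → IsChord C i j

chords : ∀ {n} {G : Graph n} → Cycle G → ℕ
chords {G = G} C = ∑ (len C) λ i → ∑ (len C) λ j →
  ind ((toℕ i Data.Nat.<ᵇ toℕ j) ∧ G (vert C i) (vert C j)
       ∧ not (cycNextᵇ (len C) i j) ∧ not (cycNextᵇ (len C) j i))

_∈C_ : ∀ {n} {G : Graph n} → Fin n → Cycle G → Set
v ∈C C = ∃ λ i → vert C i ≡ v

_∈C?_ : ∀ {n} {G : Graph n} (v : Fin n) (C : Cycle G) → Dec (v ∈C C)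
v ∈C? C = any? (λ i → vert C i ≟ v)

record Collection {n : ℕ} (G : Graph n) (m : ℕ) : Set where
  field
    cyc     : Fin m → Cycle G
    chorded : ∀ a → Chorded (cyc a)
    disj    : ∀ (a b : Fin m) → a ≢ b → ∀ (v : Fin n) → v ∈C cyc a → ¬ (v ∈C cyc b)
open Collection public

totalV : ∀ {n} {G : Graph n} {m} → Collection G m → ℕ
totalV {m = m} 𝒞 = ∑ m λ a → len (cyc 𝒞 a)

totalChords : ∀ {n} {G : Graph n} {m} → Collection G m → ℕ
totalChords {m = m} 𝒞 = ∑ m λ a → chords (cyc 𝒞 a)

InR : ∀ {n} {G : Graph n} {m} → Collection G m → Fin n → Set
InR {m = m} 𝒞 v = ∀ (a : Fin m) → ¬ (v ∈C cyc 𝒞 a)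

InR? : ∀ {n} {G : Graph n} {m} (𝒞 : Collection G m) (v : Fin n) → Dec (InR 𝒞 v)
InR? 𝒞 v = all? (λ a → ¬? (v ∈C? cyc 𝒞 a))

degR : ∀ {n} {G : Graph n} {m} → Collection G m → Fin n → ℕ
degR {n} {G} 𝒞 x = ∑ n λ y → ind (G x y ∧ does (InR? 𝒞 y))

record PathIn {n : ℕ} {G : Graph n} {m : ℕ} (𝒞 : Collection G m) : Set where
  field
    plen  : ℕ
    plen≥1 : 1 ≤ plen
    pvert : Fin plen → Fin n
    pinj  : ∀ (i j : Fin plen) → pvert i ≡ pvert j → i ≡ j
    padj  : ∀ (i j : Fin plen) → suc (toℕ i) ≡ toℕ j → Edge G (pvert i) (pvert j)
    pinR  : ∀ (i : Fin plen) → InR 𝒞 (pvert i)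
open PathIn public

_∈P_ : ∀ {n} {G : Graph n} {m} {𝒞 : Collection G m} → Fin n → PathIn 𝒞 → Set
v ∈P P = ∃ λ i → pvert P i ≡ v

IsEndpoint : ∀ {n} {G : Graph n} {m} {𝒞 : Collection G m} → PathIn 𝒞 → Fin n → Set
IsEndpoint P p = ∃ λ i → (pvert P i ≡ p) × ((toℕ i ≡ 0) ⊎ (suc (toℕ i) ≡ plen P))

Longest : ∀ {n} {G : Graph n} {m} {𝒞 : Collection G m} → PathIn 𝒞 → Set
Longest {𝒞 = 𝒞} P = ∀ (Q : PathIn 𝒞) → plen Q ≤ plen P

Optimal : ∀ {n} {G : Graph n} {m} (𝒞 : Collection G m) → PathIn 𝒞 → Set
Optimal {G = G} {m} 𝒞 P =
  (∀ (𝒟 : Collection G m) → totalV 𝒞 ≤ totalV 𝒟)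
  × (∀ (𝒟 : Collection G m) → totalV 𝒟 ≡ totalV 𝒞 → totalChords 𝒟 ≤ totalChords 𝒞)
  × (∀ (𝒟 : Collection G m) → totalV 𝒟 ≡ totalV 𝒞 → totalChords 𝒟 ≡ totalChords 𝒞
       → ∀ (Q : PathIn 𝒟) → plen Q ≤ plen P)

module Submission where

-- Lemma 19: let 𝒞 be an optimal collection of m = k − 1 disjoint chorded
-- cycles, P a longest path of R = G − V(𝒞) with end p, and v ∈ R off P.
--   • All R-neighbours of p lie on P, and there are at most two of them:
--     neighbours at positions 2 ≤ b < c of P close a chorded cycle inside R,
--     giving k disjoint chorded cycles (module Endpoint).
--   • v and p have at most six neighbours together on each cycle Cₐ.  On a
--     cycle of length ≥ 5, a vertex of R with four neighbours closes a shorter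
--     chorded cycle, against (O1) (module Minimality).  On a cycle of length
--     ≤ 4, seven neighbours let v replace a vertex cⱼ adjacent to p without
--     changing |V(𝒞)| or losing chords, after which cⱼ extends P in the new R,
--     against (O3) (module Exchange).
--   • v and p are non-adjacent, so σ₂ ≥ 6k − 2 together with the split
--     deg x ≤ ‖x, R‖ + Σₐ |N(x) ∩ V(Cₐ)| gives ‖v, R‖ + ‖p, R‖ ≥ 4, hence
--     ‖v, R‖ ≥ 2; two R-neighbours of v then span a path of three vertices.

open import Defs
open import Data.Nat using (ℕ; zero; suc; _+_; _*_; _∸_; _≤_; _<_; z≤n; s≤s; _<ᵇ_; _<?_; _≤?_)
open import Data.Nat.Properties hiding (_≟_)
open import Data.Nat using () renaming (_≟_ to _≟ℕ_)
open import Data.Nat.ListAction using () renaming (sum to sumˡ)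
open import Data.Fin using (Fin; zero; suc; toℕ; fromℕ<; _≟_; opposite; punchIn)
import Data.Fin.Properties as Fin
open import Data.Bool using (Bool; true; false; _∧_; T)
import Data.Bool as Bool
open import Data.Bool.Properties using (∧-identityʳ; ¬-not)
open import Data.Product using (_×_; ∃; _,_; proj₁; proj₂; Σ)
open import Data.Sum using (_⊎_; inj₁; inj₂)
open import Data.List using (tabulate)
open import Data.List.Properties using (map-tabulate)
open import Data.Empty using (⊥; ⊥-elim)
open import Function using (_∘_; id)
open import Relation.Nullary using (¬_; yes; no; Dec; does)
open import Relation.Nullary.Decidable using (dec-true)
open import Relation.Binary.PropositionalEquality
open import Algebra.Properties.CommutativeMonoid.Sum +-0-commutativeMonoid
  using (sum; sum-cong-≗; sum-remove; ∑-distrib-+; ∑-comm)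
open import Algebra.Properties.CommutativeSemigroup +-commutativeSemigroup using (interchange)

∑≡sum : ∀ N (f : Fin N → ℕ) → ∑ N f ≡ sum f
∑≡sum N f = trans (cong sumˡ (map-tabulate id f)) (sum-tabulate N f)
  where
  sum-tabulate : ∀ N (f : Fin N → ℕ) → sumˡ (tabulate f) ≡ sum f
  sum-tabulate zero    f = refl
  sum-tabulate (suc N) f = cong (f zero +_) (sum-tabulate N (f ∘ suc))

sum-mono-≤ : ∀ {N} {f g : Fin N → ℕ} → (∀ i → f i ≤ g i) → sum f ≤ sum g
sum-mono-≤ {zero}  _   = z≤n
sum-mono-≤ {suc N} f≤g = +-mono-≤ (f≤g zero) (sum-mono-≤ (f≤g ∘ suc))

∑-mono-≤ : ∀ N {f g : Fin N → ℕ} → (∀ i → f i ≤ g i) → ∑ N f ≤ ∑ N g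
∑-mono-≤ N f≤g = subst₂ _≤_ (sym (∑≡sum N _)) (sym (∑≡sum N _)) (sum-mono-≤ f≤g)

sum-single : ∀ {N} (f : Fin N → ℕ) i → f i ≤ sum f
sum-single f zero    = m≤m+n (f zero) _
sum-single f (suc i) = ≤-trans (sum-single (f ∘ suc) i) (m≤n+m _ (f zero))

sum-const : ∀ N c → sum {N} (λ _ → c) ≡ N * c
sum-const zero    c = refl
sum-const (suc N) c = cong (c +_) (sum-const N c)

-- Changing a single summand: if g agrees with f away from a, then
-- ∑ g − g a = ∑ f − f a, stated without subtraction.
sum-update : ∀ {N} (f g : Fin N → ℕ) a → (∀ b → b ≢ a → g b ≡ f b)
  → sum g + f a ≡ sum f + g a
sum-update {suc N} f g a agree = begin
  sum g + f a                    ≡⟨ cong (_+ f a) (sum-remove {i = a} g) ⟩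
  g a + sum (g ∘ punchIn a) + f a ≡⟨ cong (λ r → g a + r + f a) rest ⟩
  g a + r + f a                  ≡⟨ +-comm (g a + r) (f a) ⟩
  f a + (g a + r)                ≡⟨ cong (f a +_) (+-comm (g a) r) ⟩
  f a + (r + g a)                ≡⟨ +-assoc (f a) r (g a) ⟨
  f a + r + g a                  ≡⟨ cong (_+ g a) (sum-remove {i = a} f) ⟨
  sum f + g a                    ∎
  where
  open ≡-Reasoning
  r : ℕ
  r = sum (f ∘ punchIn a)
  rest : sum (g ∘ punchIn a) ≡ r
  rest = sum-cong-≗ (λ j → agree (punchIn a j) (Fin.punchInᵢ≢i a j))

ind≤1 : ∀ b → ind b ≤ 1
ind≤1 true  = s≤s z≤n
ind≤1 false = z≤n

<ᵇ-true : ∀ {s t} → (s <ᵇ t) ≡ true → s < t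
<ᵇ-true {s} {t} s<t = <ᵇ⇒< s t (subst T (sym s<t) _)

∧-split : ∀ {a b} → a ∧ b ≡ true → a ≡ true × b ≡ true
∧-split {true} {true} _ = refl , refl

does-true : ∀ {A : Set} (A? : Dec A) → does A? ≡ true → A
does-true (yes a) _ = a

count : ∀ {N} → (Fin N → Bool) → ℕ
count h = sum (λ i → ind (h i))

count≤ : ∀ {N} (h : Fin N → Bool) → count h ≤ N
count≤ {zero}  h = z≤n
count≤ {suc N} h = +-mono-≤ (ind≤1 (h zero)) (count≤ (h ∘ suc))

count-miss : ∀ {N} (h : Fin N → Bool) j → h j ≡ false → suc (count h) ≤ N
count-miss h zero    hj rewrite hj = s≤s (count≤ (h ∘ suc))
count-miss h (suc j) hj = begin
  suc (ind (h zero) + count (h ∘ suc)) ≡⟨ +-suc (ind (h zero)) _ ⟨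
  ind (h zero) + suc (count (h ∘ suc)) ≤⟨ +-mono-≤ (ind≤1 (h zero)) (count-miss (h ∘ suc) j hj) ⟩
  suc _                                ∎
  where open ≤-Reasoning

count-miss₂ : ∀ {N} (h : Fin N → Bool) i j → i ≢ j → h i ≡ false → h j ≡ false
  → 2 + count h ≤ N
count-miss₂ h zero    zero    i≢j _  _  = ⊥-elim (i≢j refl)
count-miss₂ h zero    (suc j) _   hi hj rewrite hi = s≤s (count-miss (h ∘ suc) j hj)
count-miss₂ h (suc i) zero    _   hi hj rewrite hj = s≤s (count-miss (h ∘ suc) i hi)
count-miss₂ h (suc i) (suc j) i≢j hi hj = begin
  2 + (ind (h zero) + c) ≡⟨ cong suc (+-suc (ind (h zero)) c) ⟨
  suc (ind (h zero) + suc c) ≡⟨ +-suc (ind (h zero)) (suc c) ⟨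
  ind (h zero) + (2 + c) ≤⟨ +-mono-≤ (ind≤1 (h zero)) (count-miss₂ (h ∘ suc) i j (i≢j ∘ cong suc) hi hj) ⟩
  suc _                  ∎
  where
  open ≤-Reasoning
  c : ℕ
  c = count (h ∘ suc)

pick : ∀ {N} (h : Fin N → Bool) m → suc m ≤ count h
  → ∃ λ i → h i ≡ true × m ≤ count (λ j → h j ∧ (toℕ i <ᵇ toℕ j))
pick {suc N} h m le with h zero in h₀
... | true  = zero , h₀ , subst (m ≤_) (sum-cong-≗ λ j → cong ind (sym (∧-identityʳ (h (suc j))))) (≤-pred le)
... | false with pick (h ∘ suc) m le
...   | i , hi , rest = suc i , hi , rest

ascending : ∀ {N} (h : Fin N → Bool) m → m ≤ count h
  → Σ (Fin m → Fin N) λ w → (∀ t → h (w t) ≡ true)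
      × (∀ s t → toℕ s < toℕ t → toℕ (w s) < toℕ (w t))
ascending h zero    _  = (λ ()) , (λ ()) , λ ()
ascending h (suc m) le with pick h m le
... | i , hi , rest with ascending _ m rest
...   | w , hw , mono = w′ , hw′ , mono′
  where
  w′ : Fin (suc m) → Fin _
  w′ zero    = i
  w′ (suc t) = w t
  hw′ : ∀ t → h (w′ t) ≡ true
  hw′ zero    = hi
  hw′ (suc t) = proj₁ (∧-split (hw t))
  mono′ : ∀ s t → toℕ s < toℕ t → toℕ (w′ s) < toℕ (w′ t)
  mono′ zero    (suc t) _        = <ᵇ-true (proj₂ (∧-split (hw t)))
  mono′ (suc s) (suc t) (s≤s lt) = mono s t lt

sum-delta : ∀ {N} (z : Fin N) (g : Fin N → Bool) → sum (λ y → ind (does (z ≟ y) ∧ g y)) ≡ ind (g z)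
sum-delta {suc N} zero    g = trans (cong (ind (g zero) +_) (trans (sum-const N 0) (*-zeroʳ N))) (+-identityʳ _)
sum-delta {suc N} (suc z) g = sum-delta z (g ∘ suc)

count-image : ∀ {L N} (f : Fin L → Fin N) (g S : Fin N → Bool)
  → (∀ y → g y ∧ S y ≡ true → ∃ λ i → f i ≡ y)
  → count (λ y → g y ∧ S y) ≤ count (g ∘ f)
count-image {L} {N} f g S image = begin
  count (λ y → g y ∧ S y)                            ≤⟨ sum-mono-≤ through-image ⟩
  sum (λ y → sum (λ i → ind (does (f i ≟ y) ∧ g y))) ≡⟨ ∑-comm (λ y i → ind (does (f i ≟ y) ∧ g y)) ⟩
  sum (λ i → sum (λ y → ind (does (f i ≟ y) ∧ g y))) ≡⟨ sum-cong-≗ (λ i → sum-delta (f i) g) ⟩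
  count (g ∘ f)                                      ∎
  where
  open ≤-Reasoning
  through-image : ∀ y → ind (g y ∧ S y) ≤ sum (λ i → ind (does (f i ≟ y) ∧ g y))
  through-image y with g y ∧ S y in gS
  ... | false = z≤n
  ... | true with image y gS
  ...   | i , fi≡y = begin
    1                                      ≡⟨ cong ind (proj₁ (∧-split gS)) ⟨
    ind (g y)                              ≡⟨ cong (λ b → ind (b ∧ g y)) (dec-true (f i ≟ y) fi≡y) ⟨
    ind (does (f i ≟ y) ∧ g y)             ≤⟨ sum-single (λ i → ind (does (f i ≟ y) ∧ g y)) i ⟩
    sum (λ i → ind (does (f i ≟ y) ∧ g y)) ∎

private
  overflow : ∀ {N s} → 2 + s ≤ N + N → 2 * N ≤ suc s → ⊥
  overflow {N} {s} small large =
    1+n≰n (≤-pred (≤-trans small (subst (_≤ suc s) (cong (N +_) (+-identityʳ N)) large)))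

  positive : ∀ {N x y} → 2 ≤ N → x ≤ N → 2 * N ≤ suc (x + y) → 1 ≤ y
  positive {y = suc y} _ _ _ = s≤s z≤n
  positive {N} {x} {zero} 2≤N x≤N large = ⊥-elim (overflow {N} {N} (+-monoˡ-≤ N 2≤N)
    (≤-trans large (s≤s (≤-trans (≤-reflexive (+-identityʳ x)) x≤N))))

single-exception : ∀ {N} (a b : Fin N → Bool) → 2 ≤ N → 2 * N ≤ suc (count a + count b)
  → ∃ λ j → b j ≡ true × (∀ i → i ≢ j → a i ≡ true)
single-exception {N} a b 2≤N large with Fin.any? (λ j → a j Bool.≟ false)
... | no never-false =
  let (j , bj , _) = pick b 0 (positive 2≤N (count≤ a) large)
  in j , bj , λ i _ → ¬-not (λ ai → never-false (i , ai))
... | yes (j , aj) = j , b-at-j , a-elsewhere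
  where
  b-at-j : b j ≡ true
  b-at-j with b j in bj
  ... | true  = refl
  ... | false = ⊥-elim (overflow {N} two-misses large)
    where
    two-misses : 2 + (count a + count b) ≤ N + N
    two-misses = subst (_≤ N + N) (cong suc (+-suc (count a) (count b)))
                   (+-mono-≤ (count-miss a j aj) (count-miss b j bj))
  a-elsewhere : ∀ i → i ≢ j → a i ≡ true
  a-elsewhere i i≢j with a i in ai
  ... | true  = refl
  ... | false = ⊥-elim (overflow {N} (+-mono-≤ (count-miss₂ a i j i≢j ai aj) (count≤ b)) large)

-- Reading a finite sequence Fin L → A at a natural-number position (positions
-- past the end read entry 0), so that cycles and paths can be walked along by
-- arithmetic on ℕ.
at : ∀ {A : Set} {L} → 0 < L → (Fin L → A) → ℕ → A
at {L = L} L>0 f k with k <? L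
... | yes k<L = f (fromℕ< k<L)
... | no  _   = f (fromℕ< L>0)

module _ {A : Set} {L} (L>0 : 0 < L) (f : Fin L → A) where

  at-< : ∀ {k} (k<L : k < L) → at L>0 f k ≡ f (fromℕ< k<L)
  at-< {k} k<L with k <? L
  ... | yes _   = refl
  ... | no  k≮L = ⊥-elim (k≮L k<L)

  at-toℕ : ∀ i → at L>0 f (toℕ i) ≡ f i
  at-toℕ i = trans (at-< (Fin.toℕ<n i)) (cong f (Fin.fromℕ<-toℕ i (Fin.toℕ<n i)))

  at-image : ∀ k → ∃ λ i → f i ≡ at L>0 f k
  at-image k with k <? L
  ... | yes k<L = fromℕ< k<L , refl
  ... | no  _   = fromℕ< L>0 , refl

  at-injective : (∀ i j → f i ≡ f j → i ≡ j)
    → ∀ {k k′} → k < L → k′ < L → at L>0 f k ≡ at L>0 f k′ → k ≡ k′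
  at-injective f-inj k<L k′<L eq = begin
    _                       ≡⟨ Fin.toℕ-fromℕ< k<L ⟨
    toℕ (fromℕ< k<L)        ≡⟨ cong toℕ (f-inj _ _ (trans (sym (at-< k<L)) (trans eq (at-< k′<L)))) ⟩
    toℕ (fromℕ< k′<L)       ≡⟨ Fin.toℕ-fromℕ< k′<L ⟩
    _                       ∎
    where open ≡-Reasoning

edge-irreflexive : ∀ {n} {G : Graph n} → IsSimple G → ∀ {x y} → Edge G x y → x ≢ y
edge-irreflexive (_ , loopless) {x} xy refl with trans (sym xy) (loopless x)
... | ()

edge-sym : ∀ {n} {G : Graph n} → IsSimple G → ∀ {x y} → Edge G x y → Edge G y x
edge-sym (symmetric , _) {x} {y} xy = trans (symmetric y x) xy

mkCycle : ∀ {n} (G : Graph n) (L : ℕ) (f : ℕ → Fin n) → 3 ≤ L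
  → (∀ i j → i < L → j < L → f i ≡ f j → i ≡ j)
  → (∀ i → suc i < L → Edge G (f i) (f (suc i)))
  → (∀ i → suc i ≡ L → Edge G (f i) (f 0))
  → Cycle G
mkCycle G L f 3≤L distinct step close = record
  { len = L ; len≥3 = 3≤L ; vert = f ∘ toℕ
  ; inj = λ i j eq → Fin.toℕ-injective (distinct _ _ (Fin.toℕ<n i) (Fin.toℕ<n j) eq)
  ; adj = λ { i j (inj₁ next) → subst (λ t → Edge G (f (toℕ i)) (f t)) next
                                  (step (toℕ i) (subst (_< L) (sym next) (Fin.toℕ<n j)))
            ; i j (inj₂ (last , first)) → subst (λ t → Edge G (f (toℕ i)) (f t)) (sym first)
                                  (close (toℕ i) last) } }

record Segment {n} (G : Graph n) (d : ℕ) : Set where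
  field
    seg      : ℕ → Fin n
    distinct : ∀ {t u} → t ≤ d → u ≤ d → seg t ≡ seg u → t ≡ u
    linked   : ∀ {t} → t < d → Edge G (seg t) (seg (suc t))
open Segment

module Fan {n} {G : Graph n} (sG : IsSimple G) {d} (S : Segment G d) (x : Fin n)
  (x-off : ∀ {t} → t ≤ d → x ≢ seg S t)
  (e : ℕ) (1≤e : 1 ≤ e) (e<d : e < d)
  (x~first : Edge G x (seg S 0)) (x~mid : Edge G x (seg S e)) (x~last : Edge G x (seg S d)) where

  private
    walk : ℕ → Fin n
    walk zero    = x
    walk (suc t) = seg S t

    distinct′ : ∀ i j → i < suc (suc d) → j < suc (suc d) → walk i ≡ walk j → i ≡ j
    distinct′ zero    zero    _               _               _  = refl
    distinct′ zero    (suc j) _               (s≤s (s≤s j≤d)) eq = ⊥-elim (x-off j≤d eq)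
    distinct′ (suc i) zero    (s≤s (s≤s i≤d)) _               eq = ⊥-elim (x-off i≤d (sym eq))
    distinct′ (suc i) (suc j) (s≤s (s≤s i≤d)) (s≤s (s≤s j≤d)) eq = cong suc (distinct S i≤d j≤d eq)

    step : ∀ i → suc i < suc (suc d) → Edge G (walk i) (walk (suc i))
    step zero    _               = x~first
    step (suc t) (s≤s (s≤s t<d)) = linked S t<d

    close : ∀ i → suc i ≡ suc (suc d) → Edge G (walk i) x
    close .(suc d) refl = edge-sym sG x~last

  fan : Cycle G
  fan = mkCycle G (suc (suc d)) walk (s≤s (s≤s (≤-trans 1≤e (<⇒≤ e<d)))) distinct′ step close

  fan-chorded : Chorded fan
  fan-chorded = zero , suc mid , (λ ()) , not-next , not-prev , subst (Edge G x ∘ seg S) (sym mid≡e) x~mid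
    where
    mid : Fin (suc d)
    mid = fromℕ< (m<n⇒m<1+n e<d)
    mid≡e : toℕ mid ≡ e
    mid≡e = Fin.toℕ-fromℕ< (m<n⇒m<1+n e<d)
    not-next : ¬ CycNext (suc (suc d)) zero (suc mid)
    not-next (inj₁ eq)      = <⇒≢ 1≤e (trans (suc-injective eq) mid≡e)
    not-next (inj₂ (() , _))
    not-prev : ¬ CycNext (suc (suc d)) (suc mid) zero
    not-prev (inj₁ ())
    not-prev (inj₂ (eq , _)) = <⇒≢ e<d (trans (sym mid≡e) (suc-injective (suc-injective eq)))

  fan-members : ∀ u → u ∈C fan → u ≡ x ⊎ ∃ λ t → t ≤ d × seg S t ≡ u
  fan-members u (i , eq) = on-walk (toℕ i) (Fin.toℕ<n i) eq
    where
    on-walk : ∀ t → t < suc (suc d) → walk t ≡ u → u ≡ x ⊎ ∃ λ t → t ≤ d × seg S t ≡ u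
    on-walk zero    _               eq = inj₁ (sym eq)
    on-walk (suc t) (s≤s (s≤s t≤d)) eq = inj₂ (t , t≤d , eq)

next-distinct : ∀ {L} → 3 ≤ L → ∀ {i k : Fin L} → CycNext L i k → i ≢ k
next-distinct _   (inj₁ next)          refl = 1+n≢n next
next-distinct 3≤L (inj₂ (last , first)) refl =
  <⇒≱ (s≤s (s≤s z≤n)) (subst (3 ≤_) (trans (sym last) (cong suc first)) 3≤L)

module _ {n} {G : Graph n} (C : Cycle G) where

  len>0 : 0 < len C
  len>0 = ≤-trans (s≤s z≤n) (len≥3 C)

  vertAt : ℕ → Fin n
  vertAt = at len>0 (vert C)

  vertAt-∈ : ∀ k → vertAt k ∈C C
  vertAt-∈ = at-image len>0 (vert C)

  vertAt-injective : ∀ {k k′} → k < len C → k′ < len C → vertAt k ≡ vertAt k′ → k ≡ k′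
  vertAt-injective = at-injective len>0 (vert C) (inj C)

  vertAt-adj : ∀ {k} → suc k < len C → Edge G (vertAt k) (vertAt (suc k))
  vertAt-adj {k} k+1<L = subst₂ (Edge G) (sym (at-< len>0 (vert C) k<L)) (sym (at-< len>0 (vert C) k+1<L))
    (adj C _ _ (inj₁ (trans (cong suc (Fin.toℕ-fromℕ< k<L)) (sym (Fin.toℕ-fromℕ< k+1<L)))))
    where
    k<L : k < len C
    k<L = <-trans (n<1+n k) k+1<L

  vertAt-wrap : ∀ {k} → suc k ≡ len C → Edge G (vertAt k) (vertAt 0)
  vertAt-wrap {k} last = subst₂ (Edge G) (sym (at-< len>0 (vert C) k<L)) (sym (at-< len>0 (vert C) len>0))
    (adj C _ _ (inj₂ (trans (cong suc (Fin.toℕ-fromℕ< k<L)) last , Fin.toℕ-fromℕ< len>0)))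
    where
    k<L : k < len C
    k<L = subst (k <_) last (n<1+n k)

  arc : ∀ a d → a + d < len C → Segment G d
  arc a d a+d<L = record { seg = λ t → vertAt (a + t) ; distinct = distinct′ ; linked = linked′ }
    where
    in-range : ∀ {t} → t ≤ d → a + t < len C
    in-range t≤d = ≤-<-trans (+-monoʳ-≤ a t≤d) a+d<L
    distinct′ : ∀ {t u} → t ≤ d → u ≤ d → vertAt (a + t) ≡ vertAt (a + u) → t ≡ u
    distinct′ t≤d u≤d eq = +-cancelˡ-≡ a _ _ (vertAt-injective (in-range t≤d) (in-range u≤d) eq)
    linked′ : ∀ {t} → t < d → Edge G (vertAt (a + t)) (vertAt (a + suc t))
    linked′ {t} t<d = subst (Edge G (vertAt (a + t)) ∘ vertAt) (sym (+-suc a t))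
                        (vertAt-adj (subst (_< len C) (+-suc a t) (in-range t<d)))

  wrap-arc : ∀ l d → suc l ≡ len C → d ≤ l → Segment G d
  wrap-arc l d last d≤l = record { seg = walk ; distinct = distinct′ ; linked = linked′ }
    where
    walk : ℕ → Fin n
    walk zero    = vertAt l
    walk (suc t) = vertAt t
    l<L : l < len C
    l<L = subst (l <_) last (n<1+n l)
    distinct′ : ∀ {t u} → t ≤ d → u ≤ d → walk t ≡ walk u → t ≡ u
    distinct′ {zero}  {zero}  _   _   _  = refl
    distinct′ {zero}  {suc u} _   u<d eq = ⊥-elim (<⇒≢ (≤-trans u<d d≤l)
      (sym (vertAt-injective l<L (<-trans (≤-trans u<d d≤l) l<L) eq)))
    distinct′ {suc t} {zero}  t<d _   eq = ⊥-elim (<⇒≢ (≤-trans t<d d≤l)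
      (vertAt-injective (<-trans (≤-trans t<d d≤l) l<L) l<L eq))
    distinct′ {suc t} {suc u} t<d u<d eq = cong suc (vertAt-injective
      (<-trans (≤-trans t<d d≤l) l<L) (<-trans (≤-trans u<d d≤l) l<L) eq)
    linked′ : ∀ {t} → t < d → Edge G (walk t) (walk (suc t))
    linked′ {zero}  _   = vertAt-wrap last
    linked′ {suc t} t<d = vertAt-adj (<-trans (≤-trans t<d d≤l) l<L)

-- Exchanging vertex j of a cycle C for an outside vertex x adjacent to all other
-- vertices of C gives a cycle of the same length that keeps every edge between
-- its positions; so it stays chorded and has at least as many chords.
module Swap {n} {G : Graph n} (sG : IsSimple G) (C : Cycle G) (j : Fin (len C)) (x : Fin n)
  (x∉C : ¬ (x ∈C C)) (x~ : ∀ i → i ≢ j → Edge G x (vert C i)) where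

  private
    choose : ∀ i → Dec (i ≡ j) → Fin n
    choose i (yes _) = x
    choose i (no  _) = vert C i

    vert′ : Fin (len C) → Fin n
    vert′ i = choose i (i ≟ j)

    keeps-edges : ∀ i k → i ≢ k → Edge G (vert C i) (vert C k) → Edge G (vert′ i) (vert′ k)
    keeps-edges i k i≢k ik = by-cases (i ≟ j) (k ≟ j)
      where
      by-cases : (i? : Dec (i ≡ j)) (k? : Dec (k ≡ j)) → Edge G (choose i i?) (choose k k?)
      by-cases (yes i≡j) (yes k≡j) = ⊥-elim (i≢k (trans i≡j (sym k≡j)))
      by-cases (yes _)   (no  k≢j) = x~ k k≢j
      by-cases (no  i≢j) (yes _)   = edge-sym sG (x~ i i≢j)
      by-cases (no  _)   (no  _)   = ik

    injective : ∀ i k → vert′ i ≡ vert′ k → i ≡ k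
    injective i k = by-cases (i ≟ j) (k ≟ j)
      where
      by-cases : (i? : Dec (i ≡ j)) (k? : Dec (k ≡ j)) → choose i i? ≡ choose k k? → i ≡ k
      by-cases (yes i≡j) (yes k≡j) _  = trans i≡j (sym k≡j)
      by-cases (yes _)   (no  _)   eq = ⊥-elim (x∉C (k , sym eq))
      by-cases (no  _)   (yes _)   eq = ⊥-elim (x∉C (i , eq))
      by-cases (no  _)   (no  _)   eq = inj C i k eq

  swapped : Cycle G
  swapped = record
    { len = len C ; len≥3 = len≥3 C ; vert = vert′ ; inj = injective
    ; adj = λ i k next → keeps-edges i k (next-distinct (len≥3 C) next) (adj C i k next) }

  swapped-chorded : Chorded C → Chorded swapped
  swapped-chorded (i , k , i≢k , not-next , not-prev , ik) =
    i , k , i≢k , not-next , not-prev , keeps-edges i k i≢k ik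

  more-chords : chords C ≤ chords swapped
  more-chords = ∑-mono-≤ (len C) λ i → ∑-mono-≤ (len C) λ k →
    ind-mono (toℕ i <ᵇ toℕ k) _ λ i<k → keeps-edges i k (different i<k)
    where
    different : ∀ {i k : Fin (len C)} → (toℕ i <ᵇ toℕ k) ≡ true → i ≢ k
    different {i} i<k refl = <-irrefl refl (<ᵇ-true {toℕ i} i<k)
    ind-mono : ∀ c {b b′} r → (c ≡ true → b ≡ true → b′ ≡ true) → ind (c ∧ b ∧ r) ≤ ind (c ∧ b′ ∧ r)
    ind-mono false         r _   = z≤n
    ind-mono true {false}  r _   = z≤n
    ind-mono true {true}   r imp rewrite imp refl refl = ≤-refl

  swapped-members : ∀ u → u ∈C swapped → u ≡ x ⊎ u ∈C C
  swapped-members u (i , eq) = by-cases (i ≟ j) eq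
    where
    by-cases : (i? : Dec (i ≡ j)) → choose i i? ≡ u → u ≡ x ⊎ u ∈C C
    by-cases (yes _) eq = inj₁ (sym eq)
    by-cases (no  _) eq = inj₂ (i , eq)

  removed : ¬ (vert C j ∈C swapped)
  removed (i , eq) = by-cases (i ≟ j) eq
    where
    by-cases : (i? : Dec (i ≡ j)) → choose i i? ≢ vert C j
    by-cases (yes _)   eq = x∉C (j , sym eq)
    by-cases (no  i≢j) eq = i≢j (inj C i j eq)

module _ {n} {G : Graph n} {m} {𝒞 : Collection G m} (P : PathIn 𝒞) where

  pathAt : ℕ → Fin n
  pathAt = at (plen≥1 P) (pvert P)

  pathAt-∈ : ∀ k → pathAt k ∈P P
  pathAt-∈ = at-image (plen≥1 P) (pvert P)

  pathAt-inR : ∀ k → InR 𝒞 (pathAt k)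
  pathAt-inR k with pathAt-∈ k
  ... | i , eq = subst (InR 𝒞) eq (pinR P i)

  pathAt-injective : ∀ {k k′} → k < plen P → k′ < plen P → pathAt k ≡ pathAt k′ → k ≡ k′
  pathAt-injective = at-injective (plen≥1 P) (pvert P) (pinj P)

  pathAt-adj : ∀ {k} → suc k < plen P → Edge G (pathAt k) (pathAt (suc k))
  pathAt-adj {k} k+1<L = subst₂ (Edge G) (sym (at-< (plen≥1 P) (pvert P) k<L)) (sym (at-< (plen≥1 P) (pvert P) k+1<L))
    (padj P _ _ (trans (cong suc (Fin.toℕ-fromℕ< k<L)) (sym (Fin.toℕ-fromℕ< k+1<L))))
    where
    k<L : k < plen P
    k<L = <-trans (n<1+n k) k+1<L

  tail-segment : ∀ d → suc d < plen P → Segment G d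
  tail-segment d d+1<L = record { seg = pathAt ∘ suc ; distinct = distinct′ ; linked = linked′ }
    where
    distinct′ : ∀ {t u} → t ≤ d → u ≤ d → pathAt (suc t) ≡ pathAt (suc u) → t ≡ u
    distinct′ t≤d u≤d eq = suc-injective (pathAt-injective (≤-<-trans (s≤s t≤d) d+1<L) (≤-<-trans (s≤s u≤d) d+1<L) eq)
    linked′ : ∀ {t} → t < d → Edge G (pathAt (suc t)) (pathAt (suc (suc t)))
    linked′ t<d = pathAt-adj (≤-<-trans (s≤s t<d) d+1<L)

mkPath : ∀ {n} {G : Graph n} {m} (𝒞 : Collection G m) (L : ℕ) (f : ℕ → Fin n) → 1 ≤ L
  → (∀ i j → i < L → j < L → f i ≡ f j → i ≡ j)
  → (∀ i → suc i < L → Edge G (f i) (f (suc i)))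
  → (∀ i → i < L → InR 𝒞 (f i))
  → PathIn 𝒞
mkPath {G = G} 𝒞 L f 1≤L distinct step inR = record
  { plen = L ; plen≥1 = 1≤L ; pvert = f ∘ toℕ
  ; pinj  = λ i j eq → Fin.toℕ-injective (distinct _ _ (Fin.toℕ<n i) (Fin.toℕ<n j) eq)
  ; padj  = λ i j next → subst (Edge G (f (toℕ i)) ∘ f) next
                           (step (toℕ i) (subst (_< L) (sym next) (Fin.toℕ<n j)))
  ; pinR  = λ i → inR (toℕ i) (Fin.toℕ<n i) }

single : ∀ {n} {G : Graph n} {m} (𝒞 : Collection G m) (y : Fin n) → InR 𝒞 y → PathIn 𝒞
single 𝒞 y y∈R = mkPath 𝒞 1 (λ _ → y) ≤-refl only (λ { _ (s≤s ()) }) (λ _ _ → y∈R)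
  where
  only : ∀ i j → i < 1 → j < 1 → y ≡ y → i ≡ j
  only 0 0 _ _ _ = refl
  only (suc _) _ (s≤s ()) _ _
  only _ (suc _) _ (s≤s ()) _

-- Prepending to a path P a vertex u off P that is adjacent to its first
-- vertex; the result may be read in the R of another collection 𝒟 that
-- contains u and P.
module _ {n} {G : Graph n} {m m′} {𝒞 : Collection G m} (P : PathIn 𝒞) (𝒟 : Collection G m′) (u : Fin n)
  (u∈R : InR 𝒟 u) (P⊆R : ∀ k → InR 𝒟 (pathAt P k)) (u∉P : ¬ (u ∈P P)) (u~P₀ : Edge G u (pathAt P 0)) where

  private
    walk : ℕ → Fin n
    walk zero    = u
    walk (suc k) = pathAt P k

    distinct′ : ∀ i j → i < suc (plen P) → j < suc (plen P) → walk i ≡ walk j → i ≡ j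
    distinct′ zero    zero    _          _          _  = refl
    distinct′ zero    (suc j) _          (s≤s j<L) eq = ⊥-elim (u∉P (subst (_∈P P) (sym eq) (pathAt-∈ P j)))
    distinct′ (suc i) zero    (s≤s i<L) _          eq = ⊥-elim (u∉P (subst (_∈P P) eq (pathAt-∈ P i)))
    distinct′ (suc i) (suc j) (s≤s i<L) (s≤s j<L) eq = cong suc (pathAt-injective P i<L j<L eq)

    step : ∀ i → suc i < suc (plen P) → Edge G (walk i) (walk (suc i))
    step zero    _          = u~P₀
    step (suc i) (s≤s i<L) = pathAt-adj P i<L

    inR : ∀ i → i < suc (plen P) → InR 𝒟 (walk i)
    inR zero    _ = u∈R
    inR (suc i) _ = P⊆R i

  prepend : PathIn 𝒟
  prepend = mkPath 𝒟 (suc (plen P)) walk (s≤s z≤n) distinct′ step inR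

  prepend-members : ∀ {w} → w ∈P prepend → w ≡ u ⊎ w ∈P P
  prepend-members (zero  , eq) = inj₁ (sym eq)
  prepend-members (suc i , eq) = inj₂ (subst (_∈P P) eq (pathAt-∈ P (toℕ i)))

reverse : ∀ {n} {G : Graph n} {m} {𝒞 : Collection G m} → IsSimple G → PathIn 𝒞 → PathIn 𝒞
reverse {G = G} sG P = record
  { plen = plen P ; plen≥1 = plen≥1 P ; pvert = pvert P ∘ opposite
  ; pinj = λ i j eq → trans (sym (Fin.opposite-involutive i))
                        (trans (cong opposite (pinj P _ _ eq)) (Fin.opposite-involutive j))
  ; padj = λ i j next → edge-sym sG (padj P (opposite j) (opposite i) (flip i j next))
  ; pinR = pinR P ∘ opposite }
  where
  flip : ∀ i j → suc (toℕ i) ≡ toℕ j → suc (toℕ (opposite j)) ≡ toℕ (opposite i)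
  flip i j next rewrite Fin.opposite-prop i | Fin.opposite-prop j | sym next =
    sym (+-∸-assoc 1 (subst (_< plen P) (sym next) (Fin.toℕ<n j)))

extend : ∀ {n} {G : Graph n} {m} (𝒞 : Collection G m) (D : Cycle G) → Chorded D
  → (∀ u → u ∈C D → InR 𝒞 u) → Collection G (suc m)
extend {G = G} {m} 𝒞 D D-chorded D⊆R = record { cyc = cyc′ ; chorded = chorded′ ; disj = disj′ }
  where
  cyc′ : Fin (suc m) → Cycle G
  cyc′ zero    = D
  cyc′ (suc a) = cyc 𝒞 a
  chorded′ : ∀ a → Chorded (cyc′ a)
  chorded′ zero    = D-chorded
  chorded′ (suc a) = chorded 𝒞 a
  disj′ : ∀ a b → a ≢ b → ∀ v → v ∈C cyc′ a → ¬ (v ∈C cyc′ b)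
  disj′ zero    zero    a≢b           = ⊥-elim (a≢b refl)
  disj′ zero    (suc b) _   v v∈D v∈b = D⊆R v v∈D b v∈b
  disj′ (suc a) zero    _   v v∈a v∈D = D⊆R v v∈D a v∈a
  disj′ (suc a) (suc b) a≢b = disj 𝒞 a b (a≢b ∘ cong suc)

module Replace {n} {G : Graph n} {m} (𝒞 : Collection G m) (a : Fin m) (D : Cycle G) (D-chorded : Chorded D)
  (D⊆ : ∀ u → u ∈C D → InR 𝒞 u ⊎ u ∈C cyc 𝒞 a) where

  private
    choose : ∀ b → Dec (b ≡ a) → Cycle G
    choose b (yes _) = D
    choose b (no  _) = cyc 𝒞 b

    choose-chorded : ∀ b b? → Chorded (choose b b?)
    choose-chorded b (yes _) = D-chorded
    choose-chorded b (no  _) = chorded 𝒞 b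

    disjoint : ∀ b c (b? : Dec (b ≡ a)) (c? : Dec (c ≡ a)) → b ≢ c
      → ∀ v → v ∈C choose b b? → ¬ (v ∈C choose c c?)
    disjoint b c (yes b≡a) (yes c≡a) b≢c = ⊥-elim (b≢c (trans b≡a (sym c≡a)))
    disjoint b c (yes _)   (no  c≢a) _   v v∈D v∈c with D⊆ v v∈D
    ... | inj₁ v∈R = v∈R c v∈c
    ... | inj₂ v∈a = disj 𝒞 a c (c≢a ∘ sym) v v∈a v∈c
    disjoint b c (no  b≢a) (yes _)   _   v v∈b v∈D with D⊆ v v∈D
    ... | inj₁ v∈R = v∈R b v∈b
    ... | inj₂ v∈a = disj 𝒞 a b (b≢a ∘ sym) v v∈a v∈b
    disjoint b c (no  _)   (no  _)   b≢c = disj 𝒞 b c b≢c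

    at-a : ∀ a? → choose a a? ≡ D
    at-a (yes _)  = refl
    at-a (no a≢a) = ⊥-elim (a≢a refl)

    elsewhere : ∀ b → b ≢ a → ∀ b? → choose b b? ≡ cyc 𝒞 b
    elsewhere b b≢a (yes b≡a) = ⊥-elim (b≢a b≡a)
    elsewhere b b≢a (no  _)   = refl

  replaced : Collection G m
  replaced = record
    { cyc     = λ b → choose b (b ≟ a)
    ; chorded = λ b → choose-chorded b (b ≟ a)
    ; disj    = λ b c → disjoint b c (b ≟ a) (c ≟ a) }

  replaced-total : (φ : Cycle G → ℕ)
    → ∑ m (φ ∘ cyc replaced) + φ (cyc 𝒞 a) ≡ ∑ m (φ ∘ cyc 𝒞) + φ D
  replaced-total φ = begin
    ∑ m (φ ∘ cyc replaced) + φ (cyc 𝒞 a) ≡⟨ cong (_+ φ (cyc 𝒞 a)) (∑≡sum m _) ⟩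
    sum (φ ∘ cyc replaced) + φ (cyc 𝒞 a) ≡⟨ sum-update (φ ∘ cyc 𝒞) (φ ∘ cyc replaced) a
                                              (λ b b≢a → cong φ (elsewhere b b≢a (b ≟ a))) ⟩
    sum (φ ∘ cyc 𝒞) + φ (cyc replaced a) ≡⟨ cong₂ _+_ (sym (∑≡sum m _)) (cong φ (at-a (a ≟ a))) ⟩
    ∑ m (φ ∘ cyc 𝒞) + φ D               ∎
    where open ≡-Reasoning

  replaced-R : ∀ u → (∀ b → b ≢ a → ¬ (u ∈C cyc 𝒞 b)) → ¬ (u ∈C D) → InR replaced u
  replaced-R u off-others u∉D b = by-cases (b ≟ a)
    where
    by-cases : ∀ b? → ¬ (u ∈C choose b b?)
    by-cases (yes _)   = u∉D
    by-cases (no  b≢a) = off-others b b≢a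

nbC : ∀ {n} {G : Graph n} → Fin n → Cycle G → ℕ
nbC {G = G} x C = count (λ i → G x (vert C i))

-- Every neighbour of x lies in R or on a cycle of 𝒞, so
-- deg x ≤ ‖x, R‖ + Σₐ |N(x) ∩ V(Cₐ)|.
deg-split : ∀ {n} {G : Graph n} {m} (𝒞 : Collection G m) (x : Fin n)
  → deg G x ≤ degR 𝒞 x + sum (λ a → nbC x (cyc 𝒞 a))
deg-split {n} {G} {m} 𝒞 x = begin
  deg G x                                         ≡⟨ ∑≡sum n _ ⟩
  count (G x)                                     ≤⟨ sum-mono-≤ in-R-or-on-cycle ⟩
  sum (λ y → ind (inR y) + sum (λ a → ind (on a y)))
    ≡⟨ ∑-distrib-+ (ind ∘ inR) _ ⟩
  sum (ind ∘ inR) + sum (λ y → sum (λ a → ind (on a y)))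
    ≡⟨ cong₂ _+_ (sym (∑≡sum n _)) (∑-comm (λ y a → ind (on a y))) ⟩
  degR 𝒞 x + sum (λ a → sum (λ y → ind (on a y)))
    ≤⟨ +-monoʳ-≤ (degR 𝒞 x) (sum-mono-≤ λ a → count-image (vert (cyc 𝒞 a)) (G x) (λ y → does (y ∈C? cyc 𝒞 a))
                                        (λ y gS → does-true (y ∈C? cyc 𝒞 a) (proj₂ (∧-split gS)))) ⟩
  degR 𝒞 x + sum (λ a → nbC x (cyc 𝒞 a))         ∎
  where
  open ≤-Reasoning
  inR : Fin n → Bool
  inR y = G x y ∧ does (InR? 𝒞 y)
  on : Fin m → Fin n → Bool
  on a y = G x y ∧ does (y ∈C? cyc 𝒞 a)

  in-R-or-on-cycle : ∀ y → ind (G x y) ≤ ind (inR y) + sum (λ a → ind (on a y))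
  in-R-or-on-cycle y with G x y
  ... | false = z≤n
  ... | true  = by-cases (InR? 𝒞 y)
    where
    by-cases : (R? : Dec (InR 𝒞 y)) → 1 ≤ ind (true ∧ does R?) + sum (λ a → ind (true ∧ does (y ∈C? cyc 𝒞 a)))
    by-cases (yes _)   = s≤s z≤n
    by-cases (no y∉R) with Fin.any? (λ a → y ∈C? cyc 𝒞 a)
    ... | no  on-none   = ⊥-elim (y∉R λ a y∈a → on-none (a , y∈a))
    ... | yes (a , y∈a) = ≤-trans (≤-reflexive (cong ind (sym (dec-true (y ∈C? cyc 𝒞 a) y∈a))))
                                  (sum-single (λ a → ind (does (y ∈C? cyc 𝒞 a))) a)

module Endpoint {n} {G : Graph n} {m} (sG : IsSimple G) (𝒞 : Collection G m)
  (P : PathIn 𝒞) (longest : Longest P) where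

  p : Fin n
  p = pathAt P 0

  -- A vertex of R off P adjacent to p would extend P.
  off-path-not-adjacent : ∀ {u} → InR 𝒞 u → ¬ (u ∈P P) → Edge G u p → ⊥
  off-path-not-adjacent u∈R u∉P u~p =
    1+n≰n (longest (prepend P 𝒞 _ u∈R (pathAt-inR P) u∉P u~p))

  R-neighbours-on-P : ∀ y → G p y ∧ does (InR? 𝒞 y) ≡ true → ∃ λ i → pvert P i ≡ y
  R-neighbours-on-P y p~y∈R with Fin.any? (λ i → pvert P i ≟ y)
  ... | yes y∈P = y∈P
  ... | no  y∉P = ⊥-elim (off-path-not-adjacent (does-true (InR? 𝒞 y) (proj₂ (∧-split p~y∈R)))
                            y∉P (edge-sym sG (proj₁ (∧-split p~y∈R))))

  -- If p is adjacent to positions 2 ≤ b < c of P, the fan of p over P₁ … P_c is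
  -- a chorded cycle inside R, disjoint from the m cycles of 𝒞.
  no-chord-at-endpoint : ¬ Collection G (suc m) → ∀ {b c} → 2 ≤ b → b < c → c < plen P
    → Edge G p (pathAt P b) → Edge G p (pathAt P c) → ⊥
  no-chord-at-endpoint no-more {suc e} {suc d} (s≤s 1≤e) (s≤s e<d) c<L p~b p~c =
    no-more (extend 𝒞 fan fan-chorded in-R)
    where
    p-off : ∀ {t} → t ≤ d → p ≢ pathAt P (suc t)
    p-off t≤d eq with pathAt-injective P (plen≥1 P) (≤-<-trans (s≤s t≤d) c<L) eq
    ... | ()
    open Fan sG (tail-segment P d c<L) p p-off e 1≤e e<d
      (pathAt-adj P (≤-trans (s≤s (s≤s z≤n)) c<L)) p~b p~c
    in-R : ∀ u → u ∈C fan → InR 𝒞 u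
    in-R u u∈fan with fan-members u u∈fan
    ... | inj₁ refl           = pathAt-inR P 0
    ... | inj₂ (t , _ , refl) = pathAt-inR P (suc t)

  degR-on-P : degR 𝒞 p ≤ count (λ i → G p (pvert P i))
  degR-on-P = subst (_≤ count (λ i → G p (pvert P i))) (sym (∑≡sum n _))
    (count-image (pvert P) (G p) (λ y → does (InR? 𝒞 y)) R-neighbours-on-P)

  -- Three neighbours of p on P would give positions 2 ≤ b < c as above.
  few-P-neighbours : ¬ Collection G (suc m) → ¬ (3 ≤ count (λ i → G p (pvert P i)))
  few-P-neighbours no-more three with ascending (λ i → G p (pvert P i)) 3 three
  ... | w , p~w , increasing = no-chord-at-endpoint no-more
          (≤-trans (s≤s first-positive) (increasing zero (suc zero) (s≤s z≤n)))
          (increasing (suc zero) (suc (suc zero)) (s≤s (s≤s z≤n)))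
          (Fin.toℕ<n (w (suc (suc zero)))) (p~ (suc zero)) (p~ (suc (suc zero)))
    where
    p~ : ∀ t → Edge G p (pathAt P (toℕ (w t)))
    p~ t = trans (cong (G p) (at-toℕ (plen≥1 P) (pvert P) (w t))) (p~w t)
    -- p is not adjacent to itself, so its neighbours sit at positive positions
    first-positive : 0 < toℕ (w zero)
    first-positive = n≢0⇒n>0 λ w₀≡0 → edge-irreflexive sG (p~w zero)
      (trans (cong (pathAt P) (sym w₀≡0)) (at-toℕ (plen≥1 P) (pvert P) (w zero)))

  endpoint-degree : ¬ Collection G (suc m) → degR 𝒞 p ≤ 2
  endpoint-degree no-more = ≤-trans degR-on-P (≤-pred (≰⇒> (few-P-neighbours no-more)))

module Minimality {n} {G : Graph n} {m} (sG : IsSimple G) (𝒞 : Collection G m)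
  (O1 : ∀ (𝒟 : Collection G m) → totalV 𝒞 ≤ totalV 𝒟) (a : Fin m) where

  private
    C : Cycle G
    C = cyc 𝒞 a

  no-shorter : (D : Cycle G) → Chorded D → (∀ u → u ∈C D → InR 𝒞 u ⊎ u ∈C C) → ¬ (len D < len C)
  no-shorter D D-chorded D⊆ shorter = <⇒≱ shorter (+-cancelˡ-≤ (totalV 𝒞) _ _ (begin
    totalV 𝒞 + len C        ≤⟨ +-monoˡ-≤ (len C) (O1 replaced) ⟩
    totalV replaced + len C ≡⟨ replaced-total len ⟩
    totalV 𝒞 + len D        ∎))
    where
    open Replace 𝒞 a D D-chorded D⊆
    open ≤-Reasoning

  no-short-fan : ∀ {x} → InR 𝒞 x → ∀ {d} (S : Segment G d) → (∀ t → seg S t ∈C C) → 2 + d < len C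
    → ∀ e → 1 ≤ e → e < d → Edge G x (seg S 0) → Edge G x (seg S e) → Edge G x (seg S d) → ⊥
  no-short-fan {x} x∈R S S⊆C short e 1≤e e<d x~first x~mid x~last = no-shorter fan fan-chorded D⊆ short
    where
    open Fan sG S x (λ {t} _ eq → x∈R a (subst (_∈C C) (sym eq) (S⊆C t))) e 1≤e e<d x~first x~mid x~last
    D⊆ : ∀ u → u ∈C fan → InR 𝒞 u ⊎ u ∈C C
    D⊆ u u∈fan with fan-members u u∈fan
    ... | inj₁ refl           = inj₁ x∈R
    ... | inj₂ (t , _ , refl) = inj₂ (S⊆C t)

  no-short-arc : ∀ {x} → InR 𝒞 x → ∀ {b₀ b₁ b₂} → b₀ < b₁ → b₁ < b₂ → b₂ < len C
    → Edge G x (vertAt C b₀) → Edge G x (vertAt C b₁) → Edge G x (vertAt C b₂)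
    → (∀ d → b₀ + d ≡ b₂ → 2 + d < len C) → ⊥
  no-short-arc x∈R {b₀} b₀<b₁ b₁<b₂ b₂<L x~b₀ x~b₁ x~b₂ short
    with m≤n⇒∃[o]m+o≡n (<⇒≤ b₀<b₁) | m≤n⇒∃[o]m+o≡n (<⇒≤ (<-trans b₀<b₁ b₁<b₂))
  ... | e , refl | d , refl =
    no-short-fan x∈R (arc C b₀ d b₂<L) (λ _ → vertAt-∈ C _) (short d refl) e 1≤e (+-cancelˡ-< b₀ e d b₁<b₂)
      (subst (Edge G _ ∘ vertAt C) (sym (+-identityʳ b₀)) x~b₀) x~b₁ x~b₂
    where
    1≤e : 1 ≤ e
    1≤e = +-cancelˡ-< b₀ 0 e (subst (_< b₀ + e) (sym (+-identityʳ b₀)) b₀<b₁)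

  -- Four neighbours at positions b₁ < b₂ < b₃ < b₄ always contain three that
  -- span a short arc, possibly through the closing edge of C.
  four-neighbours : ∀ {x} → InR 𝒞 x → 5 ≤ len C → ∀ b₁ b₂ b₃ b₄ → b₁ < b₂ → b₂ < b₃ → b₃ < b₄ → b₄ < len C
    → Edge G x (vertAt C b₁) → Edge G x (vertAt C b₂) → Edge G x (vertAt C b₃) → Edge G x (vertAt C b₄) → ⊥
  four-neighbours x∈R _ (suc b₁) b₂ b₃ b₄ b₁<b₂ b₂<b₃ b₃<b₄ b₄<L x~b₁ x~b₂ x~b₃ _ =
    no-short-arc x∈R b₁<b₂ b₂<b₃ (<-trans b₃<b₄ b₄<L) x~b₁ x~b₂ x~b₃
      (λ d b₁+d≡b₃ → ≤-trans (s≤s (s≤s (subst (suc d ≤_) b₁+d≡b₃ (s≤s (m≤n+m d b₁))))) (≤-trans (s≤s b₃<b₄) b₄<L))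
  four-neighbours x∈R _ zero (suc (suc b₂)) b₃ b₄ _ b₂<b₃ b₃<b₄ b₄<L _ x~b₂ x~b₃ x~b₄ =
    no-short-arc x∈R b₂<b₃ b₃<b₄ b₄<L x~b₂ x~b₃ x~b₄
      (λ d b₂+d≡b₄ → ≤-trans (s≤s (subst (suc (suc d) ≤_) b₂+d≡b₄ (s≤s (s≤s (m≤n+m d b₂))))) b₄<L)
  four-neighbours x∈R 5≤L zero (suc zero) b₃ b₄ b₁<b₂ b₂<b₃ b₃<b₄ b₄<L x~b₁ x~b₂ x~b₃ x~b₄
    with suc b₄ ≟ℕ len C
  ... | yes last = no-short-fan x∈R (wrap-arc C b₄ 2 last (≤-trans b₂<b₃ (<⇒≤ b₃<b₄)))
                     (λ { zero → vertAt-∈ C _ ; (suc _) → vertAt-∈ C _ })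
                     (≤-trans (s≤s (s≤s (s≤s (s≤s (s≤s z≤n))))) 5≤L) 1 ≤-refl ≤-refl x~b₄ x~b₁ x~b₂
  ... | no  b₄≢last = no-short-arc x∈R b₁<b₂ b₂<b₃ (<-trans b₃<b₄ b₄<L) x~b₁ x~b₂ x~b₃
      (λ { d refl → ≤-trans (s≤s (s≤s b₃<b₄)) (≤∧≢⇒< b₄<L b₄≢last) })

  at-most-three : ∀ {x} → InR 𝒞 x → 5 ≤ len C → nbC x C ≤ 3
  at-most-three {x} x∈R 5≤L = ≤-pred (≰⇒> no-four)
    where
    no-four : ¬ (4 ≤ nbC x C)
    no-four four with ascending (λ i → G x (vert C i)) 4 four
    ... | w , x~w , increasing = four-neighbours x∈R 5≤L _ _ _ _
          (increasing zero (suc zero) (s≤s z≤n))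
          (increasing (suc zero) (suc (suc zero)) (s≤s (s≤s z≤n)))
          (increasing (suc (suc zero)) (suc (suc (suc zero))) (s≤s (s≤s (s≤s z≤n))))
          (Fin.toℕ<n (w (suc (suc (suc zero)))))
          (x~ zero) (x~ (suc zero)) (x~ (suc (suc zero))) (x~ (suc (suc (suc zero))))
      where
      x~ : ∀ t → Edge G x (vertAt C (toℕ (w t)))
      x~ t = trans (cong (G x) (at-toℕ (len>0 C) (vert C) (w t))) (x~w t)

-- Under (O2) and (O3) a vertex v ∈ R off P cannot be exchanged into a cycle Cₐ
-- when v is adjacent to all vertices of Cₐ except one, cⱼ, and the first vertex
-- of P is adjacent to cⱼ: swapping v for cⱼ keeps the number of vertices and
-- does not lose chords, while cⱼ then extends P in the new R.
module Exchange {n} {G : Graph n} {m} (sG : IsSimple G) (𝒞 : Collection G m) (P : PathIn 𝒞)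
  (O2 : ∀ (𝒟 : Collection G m) → totalV 𝒟 ≡ totalV 𝒞 → totalChords 𝒟 ≤ totalChords 𝒞)
  (O3 : ∀ (𝒟 : Collection G m) → totalV 𝒟 ≡ totalV 𝒞 → totalChords 𝒟 ≡ totalChords 𝒞
       → ∀ (Q : PathIn 𝒟) → plen Q ≤ plen P) where

  no-exchange : ∀ {v} → InR 𝒞 v → ¬ (v ∈P P) → ∀ a (j : Fin (len (cyc 𝒞 a)))
    → (∀ i → i ≢ j → Edge G v (vert (cyc 𝒞 a) i)) → Edge G (pathAt P 0) (vert (cyc 𝒞 a) j) → ⊥
  no-exchange {v} v∈R v∉P a j v~ p~cⱼ =
    1+n≰n (O3 replaced same-size same-chords (prepend P replaced cⱼ cⱼ∈R′ P⊆R′ cⱼ∉P (edge-sym sG p~cⱼ)))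
    where
    C : Cycle G
    C = cyc 𝒞 a
    cⱼ : Fin n
    cⱼ = vert C j
    open Swap sG C j v (v∈R a) v~
    swapped⊆ : ∀ u → u ∈C swapped → InR 𝒞 u ⊎ u ∈C C
    swapped⊆ u u∈ with swapped-members u u∈
    ... | inj₁ refl = inj₁ v∈R
    ... | inj₂ u∈C  = inj₂ u∈C
    open Replace 𝒞 a swapped (swapped-chorded (chorded 𝒞 a)) swapped⊆

    same-size : totalV replaced ≡ totalV 𝒞
    same-size = +-cancelʳ-≡ (len C) _ _ (replaced-total len)

    same-chords : totalChords replaced ≡ totalChords 𝒞
    same-chords = ≤-antisym (O2 replaced same-size) (+-cancelʳ-≤ (chords swapped) _ _ (begin
      totalChords 𝒞 + chords swapped   ≡⟨ replaced-total chords ⟨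
      totalChords replaced + chords C  ≤⟨ +-monoʳ-≤ (totalChords replaced) more-chords ⟩
      totalChords replaced + chords swapped ∎))
      where open ≤-Reasoning

    cⱼ∈R′ : InR replaced cⱼ
    cⱼ∈R′ = replaced-R cⱼ (λ b b≢a → disj 𝒞 a b (b≢a ∘ sym) cⱼ (j , refl)) removed

    P⊆R′ : ∀ k → InR replaced (pathAt P k)
    P⊆R′ k = replaced-R _ (λ b _ → pathAt-inR P k b) not-swapped
      where
      not-swapped : ¬ (pathAt P k ∈C swapped)
      not-swapped on with swapped-members _ on
      ... | inj₁ eq   = v∉P (subst (_∈P P) eq (pathAt-∈ P k))
      ... | inj₂ on-C = pathAt-inR P k a on-C

    cⱼ∉P : ¬ (cⱼ ∈P P)
    cⱼ∉P (i , eq) = pinR P i a (j , sym eq)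

path-of-three : ∀ {n} {G : Graph n} {m} (sG : IsSimple G) (𝒞 : Collection G m) {y₁ v y₂}
  → InR 𝒞 y₁ → InR 𝒞 v → InR 𝒞 y₂ → Edge G y₁ v → Edge G v y₂ → y₁ ≢ y₂
  → Σ (PathIn 𝒞) λ Q → plen Q ≡ 3
path-of-three sG 𝒞 {y₁} {v} {y₂} y₁∈R v∈R y₂∈R y₁~v v~y₂ y₁≢y₂ =
  prepend tail 𝒞 y₁ y₁∈R (pathAt-inR tail) y₁∉tail y₁~v , refl
  where
  last : PathIn 𝒞
  last = single 𝒞 y₂ y₂∈R
  v∉last : ¬ (v ∈P last)
  v∉last (_ , y₂≡v) = edge-irreflexive sG v~y₂ (sym y₂≡v)
  tail : PathIn 𝒞
  tail = prepend last 𝒞 v v∈R (pathAt-inR last) v∉last v~y₂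
  y₁∉tail : ¬ (y₁ ∈P tail)
  y₁∉tail on with prepend-members last 𝒞 v v∈R (pathAt-inR last) v∉last v~y₂ on
  ... | inj₁ y₁≡v       = edge-irreflexive sG y₁~v y₁≡v
  ... | inj₂ (_ , y₂≡y₁) = y₁≢y₂ (sym y₂≡y₁)

Conclusion : ∀ {n} {G : Graph n} {m} (𝒞 : Collection G m) → PathIn 𝒞 → Fin n → Set
Conclusion {n} 𝒞 P p =
  (∀ (v : Fin n) → InR 𝒞 v → ¬ (v ∈P P) → (4 ≤ degR 𝒞 v + degR 𝒞 p) × (2 ≤ degR 𝒞 v))
  × (3 ≤ plen P)

-- The lemma for the first vertex p of P, with k = m + 1.
module Main {n} {G : Graph n} {m} (sG : IsSimple G) (σ₂ : σ₂≥ G (6 * suc m ∸ 2))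
  (no-more : ¬ Collection G (suc m)) (𝒞 : Collection G m) (P : PathIn 𝒞)
  (longest : Longest P) (opt : Optimal 𝒞 P) where

  open Endpoint sG 𝒞 P longest
  private
    O1 : ∀ (𝒟 : Collection G m) → totalV 𝒞 ≤ totalV 𝒟
    O1 = proj₁ opt
    O2 : ∀ (𝒟 : Collection G m) → totalV 𝒟 ≡ totalV 𝒞 → totalChords 𝒟 ≤ totalChords 𝒞
    O2 = proj₁ (proj₂ opt)
    O3 : ∀ (𝒟 : Collection G m) → totalV 𝒟 ≡ totalV 𝒞 → totalChords 𝒟 ≡ totalChords 𝒞
       → ∀ (Q : PathIn 𝒟) → plen Q ≤ plen P
    O3 = proj₂ (proj₂ opt)

  -- On a cycle of length at most 4, seven neighbours of v and p leave a single
  -- non-neighbour of v, which p sees: an exchange.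
  no-seven : ∀ {v} → InR 𝒞 v → ¬ (v ∈P P) → ∀ a → len (cyc 𝒞 a) ≤ 4
    → ¬ (7 ≤ nbC v (cyc 𝒞 a) + nbC p (cyc 𝒞 a))
  no-seven {v} v∈R v∉P a L≤4 seven =
    let j , p~cⱼ , v~others = single-exception (λ i → G v (vert C i)) (λ i → G p (vert C i))
                                (≤-trans (s≤s (s≤s z≤n)) (len≥3 C)) (≤-trans (*-monoʳ-≤ 2 L≤4) (s≤s seven))
    in no-exchange v∈R v∉P a j v~others p~cⱼ
    where
    open Exchange sG 𝒞 P O2 O3
    C : Cycle G
    C = cyc 𝒞 a

  -- A vertex v ∈ R off P and p together have at most six neighbours on each
  -- cycle Cₐ: on a cycle of length at least 5 each has at most three.
  per-cycle : ∀ {v} → InR 𝒞 v → ¬ (v ∈P P) → ∀ a → nbC v (cyc 𝒞 a) + nbC p (cyc 𝒞 a) ≤ 6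
  per-cycle {v} v∈R v∉P a with 5 ≤? len (cyc 𝒞 a)
  ... | yes 5≤L = +-mono-≤ (at-most-three v∈R 5≤L) (at-most-three (pathAt-inR P 0) 5≤L)
    where open Minimality sG 𝒞 O1 a
  ... | no  5≰L = ≤-pred (≰⇒> (no-seven v∈R v∉P a (≤-pred (≰⇒> 5≰L))))

  -- σ₂ applied to the non-adjacent pair v, p, with the neighbours of v and p
  -- on the m cycles of 𝒞 bounded by per-cycle.
  degree-sum : ∀ {v} → InR 𝒞 v → ¬ (v ∈P P) → 4 ≤ degR 𝒞 v + degR 𝒞 p
  degree-sum {v} v∈R v∉P = +-cancelʳ-≤ (m * 6) 4 _ (begin
    4 + m * 6                           ≡⟨ cong (_∸ 2) (trans (*-suc 6 m) (cong (6 +_) (*-comm 6 m))) ⟨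
    6 * suc m ∸ 2                       ≤⟨ σ₂ v p v≢p (¬-not v≁p) ⟩
    deg G v + deg G p                   ≤⟨ +-mono-≤ (deg-split 𝒞 v) (deg-split 𝒞 p) ⟩
    (degR 𝒞 v + on-cycles v) + (degR 𝒞 p + on-cycles p) ≡⟨ interchange (degR 𝒞 v) _ (degR 𝒞 p) _ ⟩
    (degR 𝒞 v + degR 𝒞 p) + (on-cycles v + on-cycles p) ≤⟨ +-monoʳ-≤ (degR 𝒞 v + degR 𝒞 p) cycles ⟩
    (degR 𝒞 v + degR 𝒞 p) + m * 6       ∎)
    where
    open ≤-Reasoning
    on-cycles : Fin n → ℕ
    on-cycles x = sum (λ a → nbC x (cyc 𝒞 a))
    cycles : on-cycles v + on-cycles p ≤ m * 6
    cycles = begin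
      on-cycles v + on-cycles p                         ≡⟨ ∑-distrib-+ (λ a → nbC v (cyc 𝒞 a)) _ ⟨
      sum (λ a → nbC v (cyc 𝒞 a) + nbC p (cyc 𝒞 a))    ≤⟨ sum-mono-≤ (per-cycle v∈R v∉P) ⟩
      sum {m} (λ _ → 6)                                 ≡⟨ sum-const m 6 ⟩
      m * 6                                             ∎
    v≢p : v ≢ p
    v≢p v≡p = v∉P (subst (_∈P P) (sym v≡p) (pathAt-∈ P 0))
    v≁p : G v p ≢ true
    v≁p = off-path-not-adjacent v∈R v∉P

  conclusion : (∃ λ w → InR 𝒞 w × ¬ (w ∈P P)) → Conclusion 𝒞 P p
  conclusion (w , w∈R , w∉P) = (λ v v∈R v∉P → degree-sum v∈R v∉P , two-in-R v∈R v∉P) , three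
    where
    two-in-R : ∀ {v} → InR 𝒞 v → ¬ (v ∈P P) → 2 ≤ degR 𝒞 v
    two-in-R {v} v∈R v∉P = +-cancelʳ-≤ 2 2 (degR 𝒞 v)
      (≤-trans (degree-sum v∈R v∉P) (+-monoʳ-≤ (degR 𝒞 v) (endpoint-degree no-more)))
    three : 3 ≤ plen P
    three = through-neighbours (ascending (λ y → G w y ∧ does (InR? 𝒞 y)) 2
                                  (subst (2 ≤_) (∑≡sum n _) (two-in-R w∈R w∉P)))
      where
      -- two R-neighbours y₀ < y₁ of w give the path y₀ w y₁
      through-neighbours : (Σ (Fin 2 → Fin n) λ y → (∀ t → G w (y t) ∧ does (InR? 𝒞 (y t)) ≡ true)
                                × (∀ s t → toℕ s < toℕ t → toℕ (y s) < toℕ (y t))) → 3 ≤ plen P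
      through-neighbours (y , w~y , increasing) = subst (_≤ plen P) (proj₂ Q) (longest (proj₁ Q))
        where
        in-R : ∀ t → InR 𝒞 (y t)
        in-R t = does-true (InR? 𝒞 (y t)) (proj₂ (∧-split (w~y t)))
        Q : Σ (PathIn 𝒞) λ Q → plen Q ≡ 3
        Q = path-of-three sG 𝒞 (in-R zero) w∈R (in-R (suc zero))
              (edge-sym sG (proj₁ (∧-split (w~y zero)))) (proj₁ (∧-split (w~y (suc zero))))
              (λ eq → <-irrefl (cong toℕ eq) (increasing zero (suc zero) (s≤s z≤n)))

module _ {n} {G : Graph n} {m} {𝒞 : Collection G m} (sG : IsSimple G) (P : PathIn 𝒞) where

  reverse-first : ∀ i → suc (toℕ i) ≡ plen P → pathAt (reverse sG P) 0 ≡ pvert P i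
  reverse-first i last = begin
    pathAt (reverse sG P) 0                    ≡⟨ cong (pathAt (reverse sG P)) opposite-at-0 ⟨
    pathAt (reverse sG P) (toℕ (opposite i))   ≡⟨ at-toℕ (plen≥1 P) (pvert P ∘ opposite) (opposite i) ⟩
    pvert P (opposite (opposite i))            ≡⟨ cong (pvert P) (Fin.opposite-involutive i) ⟩
    pvert P i                                  ∎
    where
    open ≡-Reasoning
    opposite-at-0 : toℕ (opposite i) ≡ 0
    opposite-at-0 = trans (Fin.opposite-prop i) (trans (cong (_∸ suc (toℕ i)) (sym last)) (n∸n≡0 (suc (toℕ i))))

  reverse-members : ∀ {v} → v ∈P reverse sG P → v ∈P P
  reverse-members (j , eq) = opposite j , eq

  reverse-conclusion : ∀ {q} → Conclusion 𝒞 (reverse sG P) q → Conclusion 𝒞 P q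
  reverse-conclusion (degrees , three) = (λ v v∈R v∉P → degrees v v∈R (v∉P ∘ reverse-members)) , three

lemma19 : (k n : ℕ) → 2 ≤ k → 4 * k ≤ n → (G : Graph n) → IsSimple G
    → σ₂≥ G (6 * k ∸ 2)
    → ¬ Collection G k
    → (∀ (x y : Fin n) → x ≢ y → G x y ≡ false → Collection (addEdge G x y) k)
    → (𝒞 : Collection G (k ∸ 1)) → (P : PathIn 𝒞) → Longest P → Optimal 𝒞 P
    → (p : Fin n) → IsEndpoint P p
    → (∃ λ w → InR 𝒞 w × ¬ (w ∈P P))
    → (∀ (v : Fin n) → InR 𝒞 v → ¬ (v ∈P P)
         → (4 ≤ degR 𝒞 v + degR 𝒞 p) × (2 ≤ degR 𝒞 v))
      × (3 ≤ plen P)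
lemma19 (suc m) n _ _ G sG σ₂ no-k _ 𝒞 P longest opt p (i , pᵢ≡p , first-or-last) off-P
  with first-or-last
... | inj₁ first = subst (Conclusion 𝒞 P) (trans first-is-i pᵢ≡p)
      (Main.conclusion sG σ₂ no-k 𝒞 P longest opt off-P)
  where
  first-is-i : pathAt P 0 ≡ pvert P i
  first-is-i = trans (cong (pathAt P) (sym first)) (at-toℕ (plen≥1 P) (pvert P) i)
... | inj₂ last = subst (Conclusion 𝒞 P) (trans (reverse-first sG P i last) pᵢ≡p)
      (reverse-conclusion sG P (Main.conclusion sG σ₂ no-k 𝒞 (reverse sG P) longest opt off-reverse))
  where
  off-reverse : ∃ λ w → InR 𝒞 w × ¬ (w ∈P reverse sG P)
  off-reverse = let (w , w∈R , w∉P) = off-P in w , w∈R , w∉P ∘ reverse-members sG P
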